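{- Let $a_1=(3,0,0,\dots,0)^T$ and $a_2=(0,1,1,\dots,1)^T$ in $\mathbb{Z}^{10}$. Then each of $a_1$ and $a_2$ can be extended to a $10$-icube, but the $2$-icube $A=(a_1|a_2)$ cannot be extended to a $3$-icube.
   Context: For $1\le k\le n$, a matrix $(v_1|\dots|v_k)\in\mathbb{Z}^{n\times k}$ is a $k$-icube of norm $\lambda>0$ if $v_i^Tv_j=\lambda$ for $i=j$ and $0$ for $i\ne j$. An $\ell$-icube $A$ can be extended to a $k$-icube ($\ell<k$) if some $\ell$ columns of some $k$-icube form $A$. -}

module Defs where

open import Data.Nat using (ℕ; zero; suc; _<_)
open import Data.Fin using (Fin)
open import Data.Integer using (ℤ; +_; _+_; _*_; _>_)
open import Data.Product using (Σ; _×_; ∃; _,_)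
open import Relation.Binary.PropositionalEquality using (_≡_; _≢_)
open import Function.Definitions using (Injective)

-- Integer matrices with n rows and k columns: entry M i j (row i, column j).
Mat : ℕ → ℕ → Set
Mat n k = Fin n → Fin k → ℤ

Σᶠ : (n : ℕ) → (Fin n → ℤ) → ℤ
Σᶠ zero    f = + 0
Σᶠ (suc n) f = f Data.Fin.zero + Σᶠ n (λ i → f (Data.Fin.suc i))

colDot : ∀ {n k} → Mat n k → Fin k → Fin k → ℤ
colDot {n} M i j = Σᶠ n (λ r → M r i * M r j)

IsIcubeOfNorm : (n k : ℕ) → Mat n k → ℤ → Set
IsIcubeOfNorm n k M λ₀ =
  (1 Data.Nat.≤ k) × (k Data.Nat.≤ n) × (λ₀ > + 0) ×
  (∀ i → colDot M i i ≡ λ₀) × (∀ i j → i ≢ j → colDot M i j ≡ + 0)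

IsIcube : (n k : ℕ) → Mat n k → Set
IsIcube n k M = Σ ℤ (λ λ₀ → IsIcubeOfNorm n k M λ₀)

ExtendsTo : (n ℓ k : ℕ) → Mat n ℓ → Set
ExtendsTo n ℓ k A =
  Σ (Mat n k) (λ B → IsIcube n k B ×
    Σ (Fin ℓ → Fin k) (λ σ → Injective _≡_ _≡_ σ × (∀ r j → B r (σ j) ≡ A r j)))

a₁ : Mat 10 1
a₁ Data.Fin.zero _ = + 3
a₁ (Data.Fin.suc _) _ = + 0

a₂ : Mat 10 1
a₂ Data.Fin.zero _ = + 0
a₂ (Data.Fin.suc _) _ = + 1

A₁₂ : Mat 10 2
A₁₂ r Data.Fin.zero = a₁ r Data.Fin.zero
A₁₂ r (Data.Fin.suc _) = a₂ r Data.Fin.zero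

{-# OPTIONS --safe #-}
module Submission where

-- Every column v of a 3-icube extending A = (a₁ | a₂), other than a₁ and a₂, satisfies
-- v₀ = 0 (from v ⊥ a₁) and v₁ + ⋯ + v₉ = 0 (from v ⊥ a₂), so Σ vᵣ = 0.  Since x² ≡ x
-- (mod 2), the norm Σ vᵣ² is then even, whereas the norm of the cube is ‖a₁‖² = 9.
-- The extensions of a₁ and a₂ are explicit 10 × 10 matrices M with MᵀM = 9I, and every
-- finite condition on explicit matrices is decided by evaluation.

open import Defs
open import Data.Bool using (if_then_else_)
open import Data.Fin using (Fin; zero; suc; _≟_)
open import Data.Fin.Properties using (all?; any?)
open import Data.Integer using (ℤ; +_; -[1+_]; _+_; _*_; 0ℤ)
import Data.Integer.Literals as ℤ
import Data.Nat.Literals as ℕ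
open import Data.Integer.Divisibility.Signed using (_∣_; divides; _∣?_; ∣-refl; ∣m⇒∣m*n; ∣m∣n⇒∣m+n)
open import Data.Integer.Properties using (+-identityˡ; +-identityʳ; *-zeroˡ; *-zeroʳ; *-identityʳ; *-distribʳ-+; i*j≡0⇒i≡0∨j≡0)
  renaming (_≟_ to _≟ℤ_; _<?_ to _<?ℤ_)
open import Data.Integer.Solver using (module +-*-Solver)
open import Data.Nat as ℕ using (ℕ)
open import Data.Product using (_×_; _,_; ∃)
open import Data.Sum using ([_,_]′)
open import Data.Unit using (tt)
open import Data.Vec using (Vec; []; _∷_; lookup)
open import Function using (_∘_; id)
open import Relation.Binary.PropositionalEquality using (_≡_; _≢_; refl; sym; trans; cong; cong₂; subst; module ≡-Reasoning)
open import Relation.Nullary using (¬_; Dec; does)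
open import Relation.Nullary.Decidable using (from-yes; from-no; ¬?; _×-dec_; _→-dec_)

open +-*-Solver

dot : ∀ {n} → (Fin n → ℤ) → (Fin n → ℤ) → ℤ
dot {n} u v = Σᶠ n (λ r → u r * v r)

column : ∀ {n k} → Mat n k → Fin k → Fin n → ℤ
column M j r = M r j

Σᶠ-cong : ∀ n {f g : Fin n → ℤ} → (∀ r → f r ≡ g r) → Σᶠ n f ≡ Σᶠ n g
Σᶠ-cong ℕ.zero    _   = refl
Σᶠ-cong (ℕ.suc n) f≗g = cong₂ _+_ (f≗g zero) (Σᶠ-cong n (f≗g ∘ suc))

Σᶠ-distribʳ-* : ∀ n (f : Fin n → ℤ) c → Σᶠ n (λ r → f r * c) ≡ Σᶠ n f * c
Σᶠ-distribʳ-* ℕ.zero    f c = sym (*-zeroˡ c)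
Σᶠ-distribʳ-* (ℕ.suc n) f c =
  trans (cong (_+_ (f zero * c)) (Σᶠ-distribʳ-* n (f ∘ suc) c))
        (sym (*-distribʳ-+ c (f zero) (Σᶠ n (f ∘ suc))))

dot-cong : ∀ {n} {u u′ v v′ : Fin n → ℤ} →
           (∀ r → u r ≡ u′ r) → (∀ r → v r ≡ v′ r) → dot u v ≡ dot u′ v′
dot-cong {n} u≗u′ v≗v′ = Σᶠ-cong n (λ r → cong₂ _*_ (u≗u′ r) (v≗v′ r))

2∣n*n+n : ∀ n → + 2 ∣ + n * + n + + n
2∣n*n+n ℕ.zero    = divides 0ℤ refl
2∣n*n+n (ℕ.suc n) = subst (+ 2 ∣_) step (∣m∣n⇒∣m+n (2∣n*n+n n) (∣m⇒∣m*n (+ ℕ.suc n) ∣-refl))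
  where
  step : + n * + n + + n + + 2 * (+ 1 + + n) ≡ (+ 1 + + n) * (+ 1 + + n) + (+ 1 + + n)
  step = solve 1 (λ x → x :* x :+ x :+ con (+ 2) :* (con (+ 1) :+ x)
                     := (con (+ 1) :+ x) :* (con (+ 1) :+ x) :+ (con (+ 1) :+ x)) refl (+ n)

2∣i*i+i : ∀ i → + 2 ∣ i * i + i
2∣i*i+i (+ n)    = 2∣n*n+n n
2∣i*i+i -[1+ n ] = subst (+ 2 ∣_) reflect (2∣n*n+n n)
  where
  reflect : + n * + n + + n ≡ -[1+ n ] * -[1+ n ] + -[1+ n ]
  reflect = solve 1 (λ x → x :* x :+ x
                        := (:- (con (+ 1) :+ x)) :* (:- (con (+ 1) :+ x)) :+ (:- (con (+ 1) :+ x))) refl (+ n)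

2∣dot-self+Σᶠ : ∀ n (v : Fin n → ℤ) → + 2 ∣ dot v v + Σᶠ n v
2∣dot-self+Σᶠ ℕ.zero    v = divides 0ℤ refl
2∣dot-self+Σᶠ (ℕ.suc n) v =
  subst (+ 2 ∣_) regroup (∣m∣n⇒∣m+n (2∣i*i+i (v zero)) (2∣dot-self+Σᶠ n (v ∘ suc)))
  where
  regroup : v zero * v zero + v zero + (dot (v ∘ suc) (v ∘ suc) + Σᶠ n (v ∘ suc))
          ≡ v zero * v zero + dot (v ∘ suc) (v ∘ suc) + (v zero + Σᶠ n (v ∘ suc))
  regroup = solve 3 (λ x s t → x :* x :+ x :+ (s :+ t) := x :* x :+ s :+ (x :+ t))
                    refl (v zero) (dot (v ∘ suc) (v ∘ suc)) (Σᶠ n (v ∘ suc))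

isIcubeOfNorm? : ∀ n k (M : Mat n k) λ₀ → Dec (IsIcubeOfNorm n k M λ₀)
isIcubeOfNorm? n k M λ₀ =
  1 ℕ.≤? k ×-dec k ℕ.≤? n ×-dec 0ℤ <?ℤ λ₀ ×-dec
  all? (λ i → colDot M i i ≟ℤ λ₀) ×-dec
  all? (λ i → all? λ j → ¬? (i ≟ j) →-dec colDot M i j ≟ℤ 0ℤ)

extendsTo-byColumn : ∀ {n k} (B : Mat n k) → IsIcube n k B →
                     (j : Fin k) (a : Mat n 1) → (∀ r → B r j ≡ a r zero) → ExtendsTo n 1 k a
extendsTo-byColumn B icube j a Bj≡a =
  B , icube , (λ _ → j) , (λ { {zero} {zero} _ → refl }) , λ { r zero → Bj≡a r }

avoid-two : (a b : Fin 3) → ∃ λ c → c ≢ a × c ≢ b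
avoid-two = from-yes (all? {3} λ a → all? λ b → any? λ c → ¬? (c ≟ a) ×-dec ¬? (c ≟ b))

scalarMatrix : ∀ {n} → ℤ → Mat n n
scalarMatrix c i j = if does (i ≟ j) then c else 0ℤ

B₁ : Mat 10 10
B₁ = scalarMatrix (+ 3)

B₂ : Mat 10 10
B₂ r c = lookup (lookup rows r) c
  where
  open import Agda.Builtin.FromNat using (fromNat)
  open import Agda.Builtin.FromNeg using (fromNeg)
  instance
    _ = ℕ.number
    _ = ℤ.number
    _ = ℤ.negative
    _ = tt
  rows : Vec (Vec ℤ 10) 10
  rows = ( 0 ∷ -1 ∷ -1 ∷ -1 ∷  1 ∷ -1 ∷  1 ∷  1 ∷ -1 ∷  1 ∷ [])
       ∷ ( 1 ∷  1 ∷ -1 ∷  1 ∷  0 ∷  1 ∷  1 ∷ -1 ∷ -1 ∷  1 ∷ [])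
       ∷ ( 1 ∷  0 ∷  1 ∷ -2 ∷ -1 ∷  1 ∷  0 ∷  0 ∷ -1 ∷  0 ∷ [])
       ∷ ( 1 ∷  1 ∷ -1 ∷ -1 ∷  1 ∷ -1 ∷ -1 ∷ -1 ∷  0 ∷ -1 ∷ [])
       ∷ ( 1 ∷  1 ∷  0 ∷  0 ∷  1 ∷  1 ∷  0 ∷  2 ∷  1 ∷  0 ∷ [])
       ∷ ( 1 ∷  0 ∷  0 ∷  0 ∷ -1 ∷ -1 ∷  2 ∷  0 ∷  1 ∷ -1 ∷ [])
       ∷ ( 1 ∷ -1 ∷ -1 ∷  1 ∷ -1 ∷  0 ∷ -1 ∷  1 ∷ -1 ∷ -1 ∷ [])
       ∷ ( 1 ∷  0 ∷  2 ∷  1 ∷  1 ∷ -1 ∷  0 ∷  0 ∷ -1 ∷  0 ∷ [])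
       ∷ ( 1 ∷ -2 ∷  0 ∷  0 ∷  1 ∷  1 ∷  0 ∷ -1 ∷  1 ∷  0 ∷ [])
       ∷ ( 1 ∷  0 ∷  0 ∷  0 ∷ -1 ∷ -1 ∷ -1 ∷  0 ∷  1 ∷  2 ∷ [])
       ∷ []

a₁-extends : ExtendsTo 10 1 10 a₁
a₁-extends = extendsTo-byColumn B₁ (+ 9 , from-yes (isIcubeOfNorm? 10 10 B₁ (+ 9))) zero a₁
  (from-yes (all? λ r → B₁ r zero ≟ℤ a₁ r zero))

a₂-extends : ExtendsTo 10 1 10 a₂
a₂-extends = extendsTo-byColumn B₂ (+ 9 , from-yes (isIcubeOfNorm? 10 10 B₂ (+ 9))) zero a₂
  (from-yes (all? λ r → B₂ r zero ≟ℤ a₂ r zero))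

dot-a₁ : ∀ v → dot v (column A₁₂ zero) ≡ v zero * + 3
dot-a₁ v = begin
  v zero * + 3 + Σᶠ 9 (λ r → v (suc r) * 0ℤ)  ≡⟨ cong (_+_ (v zero * + 3)) (Σᶠ-distribʳ-* 9 (v ∘ suc) 0ℤ) ⟩
  v zero * + 3 + Σᶠ 9 (v ∘ suc) * 0ℤ          ≡⟨ cong (_+_ (v zero * + 3)) (*-zeroʳ (Σᶠ 9 (v ∘ suc))) ⟩
  v zero * + 3 + 0ℤ                          ≡⟨ +-identityʳ (v zero * + 3) ⟩
  v zero * + 3                               ∎
  where open ≡-Reasoning

dot-a₂ : ∀ v → dot v (column A₁₂ (suc zero)) ≡ Σᶠ 9 (v ∘ suc)
dot-a₂ v = begin
  v zero * 0ℤ + Σᶠ 9 (λ r → v (suc r) * + 1)  ≡⟨ cong₂ _+_ (*-zeroʳ (v zero)) (Σᶠ-distribʳ-* 9 (v ∘ suc) (+ 1)) ⟩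
  0ℤ + Σᶠ 9 (v ∘ suc) * + 1                 ≡⟨ +-identityˡ (Σᶠ 9 (v ∘ suc) * + 1) ⟩
  Σᶠ 9 (v ∘ suc) * + 1                      ≡⟨ *-identityʳ (Σᶠ 9 (v ∘ suc)) ⟩
  Σᶠ 9 (v ∘ suc)                            ∎
  where open ≡-Reasoning

⊥A₁₂⇒Σᶠ≡0 : ∀ v → dot v (column A₁₂ zero) ≡ 0ℤ → dot v (column A₁₂ (suc zero)) ≡ 0ℤ → Σᶠ 10 v ≡ 0ℤ
⊥A₁₂⇒Σᶠ≡0 v v⊥a₁ v⊥a₂ = cong₂ _+_ v₀≡0 (trans (sym (dot-a₂ v)) v⊥a₂)
  where
  v₀≡0 : v zero ≡ 0ℤ
  v₀≡0 = [ id , (λ ()) ]′ (i*j≡0⇒i≡0∨j≡0 (v zero) (trans (sym (dot-a₁ v)) v⊥a₁))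

⊥A₁₂⇒2∣dot-self : ∀ v → dot v (column A₁₂ zero) ≡ 0ℤ → dot v (column A₁₂ (suc zero)) ≡ 0ℤ →
                  + 2 ∣ dot v v
⊥A₁₂⇒2∣dot-self v v⊥a₁ v⊥a₂ = subst (+ 2 ∣_) dropΣᶠ (2∣dot-self+Σᶠ 10 v)
  where
  dropΣᶠ : dot v v + Σᶠ 10 v ≡ dot v v
  dropΣᶠ = trans (cong (_+_ (dot v v)) (⊥A₁₂⇒Σᶠ≡0 v v⊥a₁ v⊥a₂)) (+-identityʳ (dot v v))

A₁₂-not-extendable : ¬ ExtendsTo 10 2 3 A₁₂
A₁₂-not-extendable (B , (λ₀ , _ , _ , _ , norm , orthogonal) , σ , _ , B∘σ≡A)
  with avoid-two (σ zero) (σ (suc zero))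
... | c , c≢σ₀ , c≢σ₁ =
  from-no (+ 2 ∣? + 9) (subst (+ 2 ∣_) (trans (norm c) λ₀≡9)
    (⊥A₁₂⇒2∣dot-self (column B c) (⊥A₁₂ zero c≢σ₀) (⊥A₁₂ (suc zero) c≢σ₁)))
  where
  column-σ : ∀ j r → column B (σ j) r ≡ column A₁₂ j r
  column-σ j r = B∘σ≡A r j

  λ₀≡9 : λ₀ ≡ + 9
  λ₀≡9 = trans (sym (norm (σ zero))) (dot-cong (column-σ zero) (column-σ zero))

  ⊥A₁₂ : ∀ j → c ≢ σ j → dot (column B c) (column A₁₂ j) ≡ 0ℤ
  ⊥A₁₂ j c≢σj =
    trans (dot-cong {u = column B c} (λ _ → refl) (sym ∘ column-σ j)) (orthogonal c (σ j) c≢σj)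

mainTheorem14 : (IsIcube 10 1 a₁ × ExtendsTo 10 1 10 a₁)
              × (IsIcube 10 1 a₂ × ExtendsTo 10 1 10 a₂)
              × (IsIcube 10 2 A₁₂ × ¬ ExtendsTo 10 2 3 A₁₂)
mainTheorem14 =
  ((+ 9 , from-yes (isIcubeOfNorm? 10 1 a₁ (+ 9))) , a₁-extends) ,
  ((+ 9 , from-yes (isIcubeOfNorm? 10 1 a₂ (+ 9))) , a₂-extends) ,
  ((+ 9 , from-yes (isIcubeOfNorm? 10 2 A₁₂ (+ 9))) , A₁₂-not-extendable)
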